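{- Every countable pseudotree can be order-embedded into $T_{\mathbb Q}$.
   Context: A pseudotree is a partial order in which the predecessors of any element are linearly ordered. $T_{\mathbb Q}$ is the set of all partial functions $f : \mathbb Q \to \omega$ such that (1) $\operatorname{dom} f$ is a proper initial segment of $\mathbb Q$, and (2) if $f \neq \emptyset$ then there is a finite sequence $-\infty = q_0 < q_1 < \dots < q_n = \max(\operatorname{dom} f)$ such that for each $i<n$, $f \restriction (q_i, q_{i+1}]$ is constant; ordered by $f \leq g$ iff $f \subseteq g$. An order-embedding is an injection $e$ with $x \leq y \iff e(x) \leq e(y)$. -}

module Defs where

open import Level using (0ℓ)
open import Data.Nat using (ℕ)
open import Data.Fin using (Fin; zero; suc; inject₁; fromℕ)
open import Data.Rational using (ℚ) renaming (_≤_ to _≤ℚ_; _<_ to _<ℚ_)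
open import Data.Product using (Σ; ∃; _×_; _,_)
open import Data.Sum using (_⊎_)
open import Relation.Nullary using (¬_)
open import Relation.Binary.PropositionalEquality using (_≡_)
open import Relation.Binary.Bundles using (Poset)
open import Function.Bundles using (_⇔_)

IsPseudotree : Poset 0ℓ 0ℓ 0ℓ → Set
IsPseudotree P = ∀ x y z → y ≤ x → z ≤ x → (y ≤ z ⊎ z ≤ y)
  where open Poset P

Countable : Poset 0ℓ 0ℓ 0ℓ → Set
Countable P = Σ (Carrier → ℕ) λ f → ∀ x y → f x ≡ f y → x ≈ y
  where open Poset P

-- The interval (q_i, q_{i+1}] for i : Fin (ℕ.suc n), where q_0 = -∞ and
-- qs i stands for q_{i+1}.  So index zero is (-∞, q_1].
InInterval : {n : ℕ} → (Fin (ℕ.suc n) → ℚ) → Fin (ℕ.suc n) → ℚ → Set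
InInterval qs zero p = p ≤ℚ qs zero
InInterval {ℕ.suc n} qs (suc i) p = (qs (inject₁ i) <ℚ p) × (p ≤ℚ qs (suc i))

-- Elements of T_ℚ: partial functions ℚ ⇀ ω, given by their graphs.
record TQ : Set₁ where
  field
    graph      : ℚ → ℕ → Set
    functional : ∀ q m k → graph q m → graph q k → m ≡ k

  dom : ℚ → Set
  dom q = ∃ (graph q)

  field
    initial    : ∀ p q → p ≤ℚ q → dom q → dom p
    proper     : ∃ λ q → ¬ dom q
    -- (2) if f ≠ ∅ there are -∞ = q_0 < q_1 < … < q_{n+1} = max (dom f)
    --     with f constant on each (q_i, q_{i+1}]
    steps      : ¬ (∀ q → ¬ dom q) →
                 Σ ℕ λ n → Σ (Fin (ℕ.suc n) → ℚ) λ qs →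
                   (∀ i j → Data.Fin._<_ i j → qs i <ℚ qs j)
                   × dom (qs (fromℕ n))
                   × (∀ p → dom p → p ≤ℚ qs (fromℕ n))
                   × (∀ i → Σ ℕ λ c → ∀ p → InInterval qs i p → dom p → graph p c)

_⊑_ : TQ → TQ → Set
f ⊑ g = ∀ q m → TQ.graph f q m → TQ.graph g q m

IsOrderEmbedding : (P : Poset 0ℓ 0ℓ 0ℓ) → (Poset.Carrier P → TQ) → Set
IsOrderEmbedding P e =
  (∀ x y → (x ≤ y) ⇔ (e x ⊑ e y))
  × (∀ x y → e x ⊑ e y → e y ⊑ e x → x ≈ y)
  where open Poset P

module Submission where

-- For elements x, z of the pseudotree P the set ↓x ∩ ↓z of common
-- lower bounds ("the part of the branch of x shared with z") is an initial
-- segment of the chain ↓x.  These sets, compared by inclusion, form a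
-- countable preorder, so they can be realised by rationals: a map
-- split : P × P → ℚ that is monotone and strictly monotone on strict
-- inclusions.  The embedding sends x to the partial function e(x) defined on
-- (-∞, split x x] whose value at p is the least code of a z with
-- p ≤ split x z, i.e. the first branch (in the enumeration of P) that has
-- not yet left the branch of x at height p.  Only the finitely many
-- heights split x z with code z ≤ code x matter, which yields the
-- step-function condition of T_ℚ.

open import Level using (0ℓ)
open import Function using (id; flip)
open import Function.Bundles using (mk⇔)
open import Data.Empty using (⊥-elim)
open import Data.Product using (Σ; ∃; _×_; _,_; proj₁; proj₂)
open import Data.Sum using (_⊎_; inj₁; inj₂; map₂)
open import Relation.Nullary using (¬_; yes; no)
open import Relation.Binary.Core using (Rel)
open import Relation.Binary.Definitions using (Reflexive; Transitive; Total; tri<; tri≈; tri>)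
open import Relation.Binary.PropositionalEquality using (_≡_; refl; sym; trans; cong; subst; subst₂)
open import Relation.Binary.Bundles using (Poset)
open import Axiom.ExcludedMiddle using (ExcludedMiddle)
open import Data.Nat as N using (ℕ; zero; suc; s≤s; z≤n)
import Data.Nat.Properties as NP
open import Data.Rational as Q using (ℚ; 0ℚ; 1ℚ)
import Data.Rational.Properties as QP
open import Data.Fin as F using (Fin; zero; suc; toℕ; fromℕ; inject₁)
import Data.Fin.Properties as FP
open import Data.List using (List; []; _∷_; length; lookup; applyUpTo; filter)
open import Data.List.Membership.Propositional using (_∈_)
open import Data.List.Membership.Propositional.Properties using (∈-lookup; ∈-filter⁺; ∈-filter⁻; ∈-applyUpTo⁺)
open import Data.List.Relation.Unary.Any using (here; there; index)
open import Data.List.Relation.Unary.Any.Properties using (lookup-index)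
open import Data.List.Relation.Unary.All as All using ([]; _∷_)
open import Data.List.Relation.Unary.AllPairs using (AllPairs; []; _∷_)
open import Defs

∀<-suc : ∀ {n} {P : ℕ → Set} → (∀ i → i N.< n → P i) → P n → ∀ i → i N.< suc n → P i
∀<-suc below at i i<1+n with NP.m<1+n⇒m<n∨m≡n i<1+n
... | inj₁ i<n = below i i<n
... | inj₂ refl = at

<⇒≱ : ∀ {p q} → p Q.< q → ¬ q Q.≤ p
<⇒≱ p<q q≤p = QP.<-irrefl refl (QP.<-≤-trans p<q q≤p)

q<q+1 : ∀ q → q Q.< q Q.+ 1ℚ
q<q+1 q = subst (Q._< q Q.+ 1ℚ) (QP.+-identityʳ q) (QP.+-mono-≤-< (QP.≤-refl {q}) (QP.positive⁻¹ 1ℚ))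

q-1<q : ∀ q → q Q.- 1ℚ Q.< q
q-1<q q = subst (q Q.- 1ℚ Q.<_) (QP.+-identityʳ q) (QP.+-mono-≤-< (QP.≤-refl {q}) (QP.negative⁻¹ (Q.- 1ℚ)))

pair : ℕ → ℕ → ℕ
pair a b = (a N.+ b) N.* (a N.+ b) N.+ a

square-gap : ∀ s a s' a' → a N.≤ s → s N.< s' → s N.* s N.+ a N.< s' N.* s' N.+ a'
square-gap s a s' a' a≤s s<s' = begin-strict
  s N.* s N.+ a         ≤⟨ NP.+-monoʳ-≤ (s N.* s) a≤s ⟩
  s N.* s N.+ s         ≡⟨ NP.+-comm (s N.* s) s ⟩
  s N.+ s N.* s         ≡⟨ sym (NP.*-suc s s) ⟩
  s N.* suc s           ≤⟨ NP.m≤n+m (s N.* suc s) s ⟩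
  s N.+ s N.* suc s     <⟨ NP.n<1+n _ ⟩
  suc s N.* suc s       ≤⟨ NP.*-mono-≤ s<s' s<s' ⟩
  s' N.* s'             ≤⟨ NP.m≤m+n (s' N.* s') a' ⟩
  s' N.* s' N.+ a'      ∎
  where open NP.≤-Reasoning

pair-injective : ∀ a b a' b' → pair a b ≡ pair a' b' → a ≡ a' × b ≡ b'
pair-injective a b a' b' eq with NP.<-cmp (a N.+ b) (a' N.+ b')
... | tri< lt _ _ = ⊥-elim (NP.<-irrefl eq (square-gap _ a _ a' (NP.m≤m+n a b) lt))
... | tri> _ _ gt = ⊥-elim (NP.<-irrefl (sym eq) (square-gap _ a' _ a (NP.m≤m+n a' b') gt))
... | tri≈ _ s≡s' _ with NP.+-cancelˡ-≡ ((a N.+ b) N.* (a N.+ b)) a a'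
                          (trans eq (cong (λ s → s N.* s N.+ a') (sym s≡s')))
...   | refl = refl , NP.+-cancelˡ-≡ a b b' s≡s'

Increasing : ∀ {n} → (Fin (suc n) → ℚ) → Set
Increasing qs = ∀ i j → i F.< j → qs i Q.< qs j

increasing⇒monotone : ∀ {n} {qs : Fin (suc n) → ℚ} → Increasing qs →
                      ∀ i k → toℕ i N.≤ toℕ k → qs i Q.≤ qs k
increasing⇒monotone {qs = qs} inc i k i≤k with NP.m≤n⇒m<n∨m≡n i≤k
... | inj₁ i<k = QP.<⇒≤ (inc i k i<k)
... | inj₂ i≡k = QP.≤-reflexive (cong qs (FP.toℕ-injective i≡k))

≤last : ∀ {n} {qs : Fin (suc n) → ℚ} → Increasing qs → ∀ i → qs i Q.≤ qs (fromℕ n)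
≤last {n} inc i = increasing⇒monotone inc i (fromℕ n)
  (subst (toℕ i N.≤_) (sym (FP.toℕ-fromℕ n)) (FP.toℕ≤pred[n] i))

inInterval⇒≤ : ∀ {n} {qs : Fin (suc n) → ℚ} i {p} → InInterval qs i p → p Q.≤ qs i
inInterval⇒≤ zero p≤ = p≤
inInterval⇒≤ {suc n} (suc i) (_ , p≤) = p≤

inInterval-below : ∀ {n} {qs : Fin (suc n) → ℚ} → Increasing qs →
                   ∀ i k {p} → InInterval qs i p → p Q.≤ qs k → qs i Q.≤ qs k
inInterval-below inc zero k _ _ = increasing⇒monotone inc zero k z≤n
inInterval-below {suc n} {qs} inc (suc i) k (q<p , _) p≤qk with toℕ (suc i) N.≤? toℕ k
... | yes i<k = increasing⇒monotone inc (suc i) k i<k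
... | no i≮k = ⊥-elim (QP.<-irrefl refl (QP.≤-<-trans p≤qk (QP.≤-<-trans qk≤q q<p)))
  where
    qk≤q : qs k Q.≤ qs (inject₁ i)
    qk≤q = increasing⇒monotone inc k (inject₁ i)
             (subst (toℕ k N.≤_) (sym (FP.toℕ-inject₁ i)) (NP.≤-pred (NP.≰⇒> i≮k)))

Strict : List ℚ → Set
Strict = AllPairs Q._<_

_≐_ : List ℚ → List ℚ → Set
S ≐ S' = (∀ {y} → y ∈ S → y ∈ S') × (∀ {y} → y ∈ S' → y ∈ S)

insert : ∀ t S → Strict S → Σ (List ℚ) λ S' → Strict S' × t ∈ S' ×
         (∀ {y} → y ∈ S → y ∈ S') × (∀ {y} → y ∈ S' → y ≡ t ⊎ y ∈ S)
insert t [] [] = t ∷ [] , [] ∷ [] , here refl , (λ ()) , λ { (here y≡t) → inj₁ y≡t }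
insert t (a ∷ as) (a<as ∷ strict) with QP.<-cmp t a
... | tri< t<a _ _ = t ∷ a ∷ as , (t<a ∷ All.map (QP.<-trans t<a) a<as) ∷ a<as ∷ strict ,
      here refl , there , λ { (here y≡t) → inj₁ y≡t ; (there y∈) → inj₂ y∈ }
... | tri≈ _ t≡a _ = a ∷ as , a<as ∷ strict , here t≡a , id , inj₂
... | tri> _ _ a<t with insert t as strict
...   | S' , strict' , t∈S' , keeps , new = a ∷ S' , All.tabulate a<S' ∷ strict' , there t∈S' ,
      (λ { (here y≡a) → here y≡a ; (there y∈) → there (keeps y∈) }) ,
      (λ { (here y≡a) → inj₂ (here y≡a) ; (there y∈) → map₂ there (new y∈) })
  where
    a<S' : ∀ {y} → y ∈ S' → a Q.< y
    a<S' y∈ with new y∈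
    ... | inj₁ refl = a<t
    ... | inj₂ y∈as = All.lookup a<as y∈as

strictSort : ∀ L → Σ (List ℚ) λ S → Strict S × L ≐ S
strictSort [] = [] , [] , (λ ()) , (λ ())
strictSort (t ∷ L) with strictSort L
... | S , strict , L⊆S , S⊆L with insert t S strict
...   | S' , strict' , t∈S' , keeps , new = S' , strict' , cover , back
  where
    cover : ∀ {y} → y ∈ t ∷ L → y ∈ S'
    cover (here refl) = t∈S'
    cover (there y∈L) = keeps (L⊆S y∈L)
    back : ∀ {y} → y ∈ S' → y ∈ t ∷ L
    back y∈ with new y∈
    ... | inj₁ refl = here refl
    ... | inj₂ y∈S = there (S⊆L y∈S)

lookup-increasing : ∀ {S} → Strict S → ∀ i j → i F.< j → lookup S i Q.< lookup S j
lookup-increasing (s<ss ∷ _) zero (suc j) _ = All.lookup s<ss (∈-lookup j)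
lookup-increasing (_ ∷ strict) (suc i) (suc j) (s≤s i<j) = lookup-increasing strict i j i<j

enumerate : ∀ L {t} → t ∈ L → Σ ℕ λ n → Σ (Fin (suc n) → ℚ) λ qs →
            Increasing qs × (∀ i → qs i ∈ L) × (∀ {y} → y ∈ L → ∃ λ k → y ≡ qs k)
enumerate L t∈L with strictSort L
... | S , strict , L⊆S , S⊆L with L⊆S t∈L
enumerate L t∈L | [] , _ , _ , _ | ()
enumerate L t∈L | s ∷ ss , strict , L⊆S , S⊆L | _ =
  length ss , lookup (s ∷ ss) , lookup-increasing strict ,
  (λ i → S⊆L (∈-lookup i)) , λ y∈L → index (L⊆S y∈L) , lookup-index (L⊆S y∈L)

-- From here on excluded middle is assumed: the order of P, and hence every
-- predicate built from it, need not be decidable.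

module Classical (em : ExcludedMiddle 0ℓ) where

  module Extremum {A : Set} (_⊴_ : Rel A 0ℓ) (⊴-refl : Reflexive _⊴_)
                  (⊴-trans : Transitive _⊴_) (⊴-total : Total _⊴_) where

    Maximiser : ℕ → (ℕ → Set) → (ℕ → A) → Set
    Maximiser n P G = Σ ℕ λ a → a N.< n × P a × (∀ i → i N.< n → P i → G i ⊴ G a)

    maximise : ∀ n P G → (∀ i → i N.< n → ¬ P i) ⊎ Maximiser n P G
    maximise zero P G = inj₁ λ i ()
    maximise (suc n) P G with maximise n P G | em {P n}
    ... | inj₁ none | no ¬pn = inj₁ (∀<-suc none ¬pn)
    ... | inj₁ none | yes pn = inj₂ (n , NP.n<1+n n , pn , ∀<-suc (λ i i<n pi → ⊥-elim (none i i<n pi)) (λ _ → ⊴-refl))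
    ... | inj₂ (a , a<n , pa , max) | no ¬pn = inj₂ (a , NP.m≤n⇒m≤1+n a<n , pa , ∀<-suc max (λ pn → ⊥-elim (¬pn pn)))
    ... | inj₂ (a , a<n , pa , max) | yes pn with ⊴-total (G a) (G n)
    ...   | inj₁ a⊴n = inj₂ (n , NP.n<1+n n , pn , ∀<-suc (λ i i<n pi → ⊴-trans (max i i<n pi) a⊴n) (λ _ → ⊴-refl))
    ...   | inj₂ n⊴a = inj₂ (a , NP.m≤n⇒m≤1+n a<n , pa , ∀<-suc max (λ _ → n⊴a))

  module Max = Extremum Q._≤_ QP.≤-refl QP.≤-trans QP.≤-total
  module Min = Extremum (flip Q._≤_) QP.≤-refl (flip QP.≤-trans) (flip QP.≤-total)
  module Least = Extremum (flip N._≤_) NP.≤-refl (flip NP.≤-trans) (flip NP.≤-total)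

  minimal : (P : ℕ → Set) → ∀ {n} → P n → Σ ℕ λ k → P k × (∀ j → P j → k N.≤ j)
  minimal P {n} pn with Least.maximise (suc n) P id
  ... | inj₁ none = ⊥-elim (none n (NP.n<1+n n) pn)
  ... | inj₂ (k , k<1+n , pk , least) = k , pk , below
    where
      below : ∀ j → P j → k N.≤ j
      below j pj with j N.<? suc n
      ... | yes j<1+n = least j j<1+n pj
      ... | no j≮1+n = NP.<⇒≤ (NP.<-≤-trans k<1+n (NP.≮⇒≥ j≮1+n))

  -- Realising a transitive relation ≺ on ℕ by rationals: a map H with
  -- H i ≤ H j whenever i ≺ j, strictly unless also j ≺ i.  H is built
  -- greedily, choosing the value of index n once those below n are fixed.

  module Realise (_≺_ : Rel ℕ 0ℓ) (≺-trans : Transitive _≺_) where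

    Fits : ℕ → ℕ → ℚ → ℚ → Set
    Fits i j a b = i ≺ j → (a Q.≤ b) × (¬ j ≺ i → a Q.< b)

    Faithful : ℕ → (ℕ → ℚ) → Set
    Faithful n G = ∀ i j → i N.< n → j N.< n → Fits i j (G i) (G j)

    Admissible : ℕ → (ℕ → ℚ) → ℚ → Set
    Admissible n G v = ∀ i → i N.< n → Fits i n (G i) v × Fits n i v (G i)

    copy-admissible : ∀ {n G k} → Faithful n G → k N.< n → k ≺ n → n ≺ k → Admissible n G (G k)
    copy-admissible {n} {G} {k} faithful k<n k≺n n≺k i i<n = below , above
      where
        below : Fits i n (G i) (G k)
        below i≺n with faithful i k i<n k<n (≺-trans i≺n n≺k)
        ... | ≤ , < = ≤ , λ n⊀i → < λ k≺i → n⊀i (≺-trans n≺k k≺i)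
        above : Fits n i (G k) (G i)
        above n≺i with faithful k i k<n i<n (≺-trans k≺n n≺i)
        ... | ≤ , < = ≤ , λ i⊀n → < λ i≺k → i⊀n (≺-trans i≺k k≺n)

    Separated : ℕ → (ℕ → ℚ) → ℚ → Set
    Separated n G v = (∀ i → i N.< n → i ≺ n → G i Q.< v) × (∀ i → i N.< n → n ≺ i → v Q.< G i)

    separated⇒admissible : ∀ {n G v} → Separated n G v → Admissible n G v
    separated⇒admissible (lower , upper) i i<n =
      (λ i≺n → QP.<⇒≤ (lower i i<n i≺n) , λ _ → lower i i<n i≺n) ,
      (λ n≺i → QP.<⇒≤ (upper i i<n n≺i) , λ _ → upper i i<n n≺i)

    -- Without an earlier equivalent index, the largest predecessor value is
    -- below the smallest successor value, so there is room in between.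
    gap : ∀ {n G} → Faithful n G → ¬ (∃ λ k → k N.< n × k ≺ n × n ≺ k) → Σ ℚ (Separated n G)
    gap {n} {G} faithful no-equiv with Max.maximise n (_≺ n) G | Min.maximise n (n ≺_) G
    ... | inj₁ none-below | inj₁ none-above =
      0ℚ , (λ i i<n i≺n → ⊥-elim (none-below i i<n i≺n)) , (λ i i<n n≺i → ⊥-elim (none-above i i<n n≺i))
    ... | inj₂ (a , _ , _ , max) | inj₁ none-above =
      G a Q.+ 1ℚ , (λ i i<n i≺n → QP.≤-<-trans (max i i<n i≺n) (q<q+1 (G a))) ,
                   (λ i i<n n≺i → ⊥-elim (none-above i i<n n≺i))
    ... | inj₁ none-below | inj₂ (b , _ , _ , min) =
      G b Q.- 1ℚ , (λ i i<n i≺n → ⊥-elim (none-below i i<n i≺n)) ,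
                   (λ i i<n n≺i → QP.<-≤-trans (q-1<q (G b)) (min i i<n n≺i))
    ... | inj₂ (a , a<n , a≺n , max) | inj₂ (b , b<n , n≺b , min)
      with QP.<-dense (proj₂ (faithful a b a<n b<n (≺-trans a≺n n≺b))
                             (λ b≺a → no-equiv (b , b<n , ≺-trans b≺a a≺n , n≺b)))
    ...   | v , a<v , v<b = v , (λ i i<n i≺n → QP.≤-<-trans (max i i<n i≺n) a<v) ,
                                (λ i i<n n≺i → QP.<-≤-trans v<b (min i i<n n≺i))

    admissible : ∀ {n G} → Faithful n G → Σ ℚ (Admissible n G)
    admissible {n} {G} faithful with em {∃ λ k → k N.< n × k ≺ n × n ≺ k}
    ... | yes (k , k<n , k≺n , n≺k) = G k , copy-admissible faithful k<n k≺n n≺k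
    ... | no no-equiv with gap faithful no-equiv
    ...   | v , separated = v , separated⇒admissible separated

    update : (ℕ → ℚ) → ℕ → ℚ → ℕ → ℚ
    update G n v i with i N.≟ n
    ... | yes _ = v
    ... | no _ = G i

    update-here : ∀ G n v → update G n v n ≡ v
    update-here G n v with n N.≟ n
    ... | yes _ = refl
    ... | no n≢n = ⊥-elim (n≢n refl)

    update-below : ∀ G n v i → i N.< n → update G n v i ≡ G i
    update-below G n v i i<n with i N.≟ n
    ... | yes refl = ⊥-elim (NP.<-irrefl refl i<n)
    ... | no _ = refl

    extend : ∀ {n G v} → Faithful n G → Admissible n G v → Faithful (suc n) (update G n v)
    extend {n} {G} {v} faithful adm i j i< j< with NP.m<1+n⇒m<n∨m≡n i< | NP.m<1+n⇒m<n∨m≡n j<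
    ... | inj₁ i<n | inj₁ j<n rewrite update-below G n v i i<n | update-below G n v j j<n = faithful i j i<n j<n
    ... | inj₁ i<n | inj₂ refl rewrite update-below G n v i i<n | update-here G n v = proj₁ (adm i i<n)
    ... | inj₂ refl | inj₁ j<n rewrite update-below G n v j j<n | update-here G n v = proj₂ (adm j j<n)
    ... | inj₂ refl | inj₂ refl = λ i≺i → QP.≤-refl , λ i⊀i → ⊥-elim (i⊀i i≺i)

    stage : ∀ n → Σ (ℕ → ℚ) (Faithful n)
    stage zero = (λ _ → 0ℚ) , λ i j ()
    stage (suc n) = update G n v , extend faithful adm
      where
        G = proj₁ (stage n)
        faithful = proj₂ (stage n)
        v = proj₁ (admissible faithful)
        adm = proj₂ (admissible faithful)

    H : ℕ → ℚ
    H i = proj₁ (stage (suc i)) i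

    stable : ∀ m i → i N.< m → proj₁ (stage m) i ≡ H i
    stable (suc m) i i<1+m with NP.m<1+n⇒m<n∨m≡n i<1+m
    ... | inj₂ refl = refl
    ... | inj₁ i<m = trans (update-below _ m _ i i<m) (stable m i i<m)

    H-fits : ∀ i j → Fits i j (H i) (H j)
    H-fits i j = subst₂ (Fits i j) (stable m i i<m) (stable m j j<m) (proj₂ (stage m) i j i<m j<m)
      where
        m = suc (i N.⊔ j)
        i<m = s≤s (NP.m≤m⊔n i j)
        j<m = s≤s (NP.m≤n⊔m i j)

  module RealiseCountable {S : Set} (R : Rel S 0ℓ) (R-trans : Transitive R)
                          (idx : S → ℕ) (same-index : ∀ a b → idx a ≡ idx b → R a b) where

    _≺_ : Rel ℕ 0ℓ
    i ≺ j = Σ S λ a → Σ S λ b → idx a ≡ i × idx b ≡ j × R a b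

    ≺-trans : Transitive _≺_
    ≺-trans (a , b , refl , refl , Rab) (b' , c , b'≡b , refl , Rb'c) =
      a , c , refl , refl , R-trans Rab (R-trans (same-index b b' (sym b'≡b)) Rb'c)

    open Realise _≺_ ≺-trans using (H; H-fits)

    realised : ℕ → ℚ
    realised = H

    h : S → ℚ
    h a = realised (idx a)

    h-mono : ∀ {a b} → R a b → h a Q.≤ h b
    h-mono {a} {b} Rab = proj₁ (H-fits (idx a) (idx b) (a , b , refl , refl , Rab))

    h-strict : ∀ {a b} → R a b → ¬ R b a → h a Q.< h b
    h-strict {a} {b} Rab ¬Rba = proj₂ (H-fits (idx a) (idx b) (a , b , refl , refl , Rab))
      λ { (b' , a' , b'≡b , a'≡a , Rb'a') →
          ¬Rba (R-trans (same-index b b' (sym b'≡b)) (R-trans Rb'a' (same-index a' a a'≡a))) }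

  module Embedding (P : Poset 0ℓ 0ℓ 0ℓ) (pseudotree : IsPseudotree P) (countable : Countable P) where
    open Poset P using (Carrier; _≈_; _≤_)
      renaming (refl to ≤-refl; trans to ≤-trans; reflexive to ≤-reflexive; antisym to ≤-antisym)

    code : Carrier → ℕ
    code = proj₁ countable

    code-injective : ∀ x y → code x ≡ code y → x ≈ y
    code-injective = proj₂ countable

    -- A pair (x , z) stands for the common part ↓x ∩ ↓z of the branches of
    -- x and z; pairs are preordered by inclusion of these sets.
    _⊆↓_ : Rel (Carrier × Carrier) 0ℓ
    (x , z) ⊆↓ (x' , z') = ∀ w → w ≤ x → w ≤ z → w ≤ x' × w ≤ z'

    ⊆↓-trans : Transitive _⊆↓_
    ⊆↓-trans inc inc' w w≤x w≤z = inc' w (proj₁ (inc w w≤x w≤z)) (proj₂ (inc w w≤x w≤z))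

    pair-code : Carrier × Carrier → ℕ
    pair-code (x , z) = pair (code x) (code z)

    same-pair-code : ∀ a b → pair-code a ≡ pair-code b → a ⊆↓ b
    same-pair-code (x , z) (x' , z') eq with pair-injective (code x) (code z) (code x') (code z') eq
    ... | x≡ , z≡ = λ w w≤x w≤z → ≤-trans w≤x (≤-reflexive (code-injective x x' x≡)) ,
                                  ≤-trans w≤z (≤-reflexive (code-injective z z' z≡))

    open RealiseCountable _⊆↓_ ⊆↓-trans pair-code same-pair-code using (realised; h; h-mono; h-strict)

    -- split x z: the height at which the branch of z leaves that of x.
    split : Carrier → Carrier → ℚ
    split x z = h (x , z)

    height : Carrier → ℚ
    height x = split x x

    split≤height : ∀ x z → split x z Q.≤ height x
    split≤height x z = h-mono λ w w≤x _ → w≤x , w≤x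

    height≤split : ∀ {x y z} → y ≤ x → y ≤ z → height y Q.≤ split x z
    height≤split y≤x y≤z = h-mono λ w w≤y _ → ≤-trans w≤y y≤x , ≤-trans w≤y y≤z

    split<height : ∀ {x y z} → (y , z) ⊆↓ (x , x) → ¬ (x ≤ y × x ≤ z) → split y z Q.< height x
    split<height inc x∉ = h-strict inc λ inc' → x∉ (inc' _ ≤-refl ≤-refl)

    -- For y ≤ x and p at most the height of y: p ≤ split x z iff p ≤ split y z.
    -- Either y ≤ z and both split points are above p, or (pseudotree
    -- property) ↓x ∩ ↓z = ↓y ∩ ↓z.
    split-coherent : ∀ {x y} z {p} → y ≤ x → p Q.≤ height y →
                     (p Q.≤ split x z → p Q.≤ split y z) × (p Q.≤ split y z → p Q.≤ split x z)
    split-coherent {x} {y} z {p} y≤x p≤y with em {y ≤ z}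
    ... | yes y≤z = (λ _ → QP.≤-trans p≤y (height≤split ≤-refl y≤z)) ,
                    (λ _ → QP.≤-trans p≤y (height≤split y≤x y≤z))
    ... | no y≰z = (λ p≤ → QP.≤-trans p≤ (h-mono x→y)) , (λ p≤ → QP.≤-trans p≤ (h-mono y→x))
      where
        x→y : (x , z) ⊆↓ (y , z)
        x→y w w≤x w≤z with pseudotree x w y w≤x y≤x
        ... | inj₁ w≤y = w≤y , w≤z
        ... | inj₂ y≤w = ⊥-elim (y≰z (≤-trans y≤w w≤z))
        y→x : (y , z) ⊆↓ (x , z)
        y→x w w≤y w≤z = ≤-trans w≤y y≤x , w≤z

    Label : Carrier → ℚ → ℕ → Set
    Label x p k = (∃ λ z → p Q.≤ split x z × code z ≡ k) × (∀ z → p Q.≤ split x z → k N.≤ code z)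

    label-functional : ∀ x p m k → Label x p m → Label x p k → m ≡ k
    label-functional x p m k ((z , p≤ , refl) , least) ((z' , p≤' , refl) , least') =
      NP.≤-antisym (least z' p≤') (least' z p≤)

    Defined : Carrier → ℚ → Set
    Defined x p = ∃ (Label x p)

    defined⇒≤height : ∀ {x p} → Defined x p → p Q.≤ height x
    defined⇒≤height {x} (_ , (z , p≤ , _) , _) = QP.≤-trans p≤ (split≤height x z)

    ≤height⇒defined : ∀ {x p} → p Q.≤ height x → Defined x p
    ≤height⇒defined {x} {p} p≤ with minimal (λ k → ∃ λ z → p Q.≤ split x z × code z ≡ k) (x , p≤ , refl)
    ... | k , witness , least = k , witness , λ z p≤z → least (code z) (z , p≤z , refl)

    label-spread : ∀ {x p q c} → p Q.≤ q →
                   (∀ z → code z N.≤ code x → p Q.≤ split x z → q Q.≤ split x z) →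
                   Label x q c → Label x p c
    label-spread {x} {p} {q} {c} p≤q gaps ((z , q≤z , cz) , least) = (z , QP.≤-trans p≤q q≤z , cz) , least'
      where
        c≤x : c N.≤ code x
        c≤x = least x (QP.≤-trans q≤z (split≤height x z))
        least' : ∀ z' → p Q.≤ split x z' → c N.≤ code z'
        least' z' p≤z' with code z' N.≤? code x
        ... | yes z'≤x = least z' (gaps z' z'≤x p≤z')
        ... | no z'≰x = NP.≤-trans c≤x (NP.<⇒≤ (NP.≰⇒> z'≰x))

    -- The candidate step points of e(x): the split points of x with the
    -- elements of code at most code x (the label never exceeds code x),
    -- restricted to the domain of e(x).
    breakpoint : Carrier → ℕ → ℚ
    breakpoint x k = realised (pair (code x) k)

    breakpoints : Carrier → List ℚ
    breakpoints x = filter (Q._≤? height x) (applyUpTo (breakpoint x) (suc (code x)))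

    split∈breakpoints : ∀ x z → code z N.≤ code x → split x z ∈ breakpoints x
    split∈breakpoints x z z≤x =
      ∈-filter⁺ (Q._≤? height x) (∈-applyUpTo⁺ (breakpoint x) (s≤s z≤x)) (split≤height x z)

    Steps : Carrier → Set
    Steps x = Σ ℕ λ n → Σ (Fin (suc n) → ℚ) λ qs →
      Increasing qs × Defined x (qs (fromℕ n)) × (∀ p → Defined x p → p Q.≤ qs (fromℕ n)) ×
      (∀ i → Σ ℕ λ c → ∀ p → InInterval qs i p → Defined x p → Label x p c)

    steps : ∀ x → Steps x
    steps x with enumerate (breakpoints x) (split∈breakpoints x x NP.≤-refl)
    ... | n , qs , inc , qs∈ , covered = n , qs , inc , ≤height⇒defined (qs≤height (fromℕ n)) , top , constant
      where
        qs≤height : ∀ i → qs i Q.≤ height x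
        qs≤height i = proj₂ (∈-filter⁻ (Q._≤? height x) {xs = applyUpTo (breakpoint x) (suc (code x))} (qs∈ i))

        top : ∀ p → Defined x p → p Q.≤ qs (fromℕ n)
        top p defined with covered (split∈breakpoints x x NP.≤-refl)
        ... | k , x≡qk = QP.≤-trans (defined⇒≤height defined) (subst (Q._≤ qs (fromℕ n)) (sym x≡qk) (≤last inc k))

        constant : ∀ i → Σ ℕ λ c → ∀ p → InInterval qs i p → Defined x p → Label x p c
        constant i with ≤height⇒defined (qs≤height i)
        ... | c , label = c , λ p p∈i _ → label-spread (inInterval⇒≤ i p∈i) (gaps p∈i) label
          where
            gaps : ∀ {p} → InInterval qs i p → ∀ z → code z N.≤ code x → p Q.≤ split x z → qs i Q.≤ split x z
            gaps p∈i z z≤x p≤z with covered (split∈breakpoints x z z≤x)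
            ... | k , z≡qk rewrite z≡qk = inInterval-below inc i k p∈i p≤z

    embed : Carrier → TQ
    embed x = record
      { graph      = Label x
      ; functional = label-functional x
      ; initial    = λ p q p≤q defined → ≤height⇒defined (QP.≤-trans p≤q (defined⇒≤height defined))
      ; proper     = height x Q.+ 1ℚ , λ defined →
                       <⇒≱ (q<q+1 (height x)) (defined⇒≤height defined)
      ; steps      = λ _ → steps x
      }

    embed-mono : ∀ {x y} → x ≤ y → embed x ⊑ embed y
    embed-mono {x} {y} x≤y p k ((z , p≤z , cz) , least) =
      (z , proj₂ coherent p≤z , cz) , λ z' p≤z' → least z' (proj₁ (split-coherent z' x≤y p≤x) p≤z')
      where
        p≤x : p Q.≤ height x
        p≤x = QP.≤-trans p≤z (split≤height x z)
        coherent = split-coherent z x≤y p≤x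

    top-label-above : ∀ {x z} → height x Q.≤ split x z → x ≤ z
    top-label-above {x} {z} x≤z with em {x ≤ z}
    ... | yes x≤z = x≤z
    ... | no x≰z = ⊥-elim (<⇒≱ (split<height (λ w w≤x _ → w≤x , w≤x) (λ (_ , x≤z) → x≰z x≤z)) x≤z)

    -- Order reflection: e(y) can only carry the top label of x if x ≤ y.
    embed-reflects : ∀ {x y} → embed x ⊑ embed y → x ≤ y
    embed-reflects {x} {y} sub with em {x ≤ y}
    ... | yes x≤y = x≤y
    ... | no x≰y with ≤height⇒defined {x} (QP.≤-refl {height x})
    ...   | k , label with label | sub (height x) k label
    ...     | (z , x≤z , cz) , _ | (z' , x≤yz' , cz') , _ = ⊥-elim (<⇒≱ (split<height below x∉) x≤yz')
      where
        x≤z' : x ≤ z'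
        x≤z' = ≤-trans (top-label-above x≤z) (≤-reflexive (code-injective z z' (trans cz (sym cz'))))
        below : (y , z') ⊆↓ (x , x)
        below w w≤y w≤z' with pseudotree z' w x w≤z' x≤z'
        ... | inj₁ w≤x = w≤x , w≤x
        ... | inj₂ x≤w = ⊥-elim (x≰y (≤-trans x≤w w≤y))
        x∉ : ¬ (x ≤ y × x ≤ z')
        x∉ (x≤y , _) = x≰y x≤y

    embedding : Σ (Carrier → TQ) λ e → IsOrderEmbedding P e
    embedding = embed , (λ x y → mk⇔ embed-mono embed-reflects) ,
                λ x y ex⊑ey ey⊑ex → ≤-antisym (embed-reflects ex⊑ey) (embed-reflects ey⊑ex)

corollary4p16 : ExcludedMiddle 0ℓ → (P : Poset 0ℓ 0ℓ 0ℓ) → IsPseudotree P → Countable P →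
    Σ (Poset.Carrier P → TQ) λ e → IsOrderEmbedding P e
corollary4p16 em P pseudotree countable = Classical.Embedding.embedding em P pseudotree countable
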